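{- Let $d\ge 0$ be an integer and let $G$ be a $d$-degenerate graph. Let $D\subseteq V(G)$ be the set of all vertices of degree at most $2d$ in $G$. Then $|V(G)| \le (2d+1)|D|$.
   Context: All graphs are finite and simple. A graph $G$ is $d$-degenerate if every induced subgraph of $G$ has a vertex of degree at most $d$. -}

module Defs where

open import Data.Nat using (ℕ; _≤_; _≤?_)
open import Data.Bool using (_∧_)
open import Data.Vec using (lookup)
open import Relation.Nullary.Decidable using (⌊_⌋)
open import Data.Bool using (Bool; true; false)
open import Data.Fin using (Fin)
open import Data.Fin.Subset using (Subset; _∈_; ∣_∣; ⁅_⁆; Nonempty)
open import Data.Vec using (tabulate)
open import Data.Product using (Σ; _×_)
open import Relation.Binary.PropositionalEquality using (_≡_)
open import Relation.Nullary using (¬_)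

record Graph (n : ℕ) : Set where
  field
    adj     : Fin n → Fin n → Bool
    sym     : ∀ u v → adj u v ≡ adj v u
    irrefl  : ∀ v → adj v v ≡ false

open Graph public

nbrsIn : ∀ {n} → Graph n → Subset n → Fin n → Subset n
nbrsIn G S v = tabulate λ u → lookup S u ∧ adj G v u

degIn : ∀ {n} → Graph n → Subset n → Fin n → ℕ
degIn G S v = ∣ nbrsIn G S v ∣

deg : ∀ {n} → Graph n → Fin n → ℕ
deg G v = degIn G (tabulate λ _ → true) v

Degenerate : ∀ {n} → ℕ → Graph n → Set
Degenerate d G = ∀ S → Nonempty S → Σ _ λ v → (v ∈ S) × (degIn G S v ≤ d)

lowDeg : ∀ {n} → Graph n → ℕ → Subset n
lowDeg G k = tabulate λ v → ⌊ deg G v ≤? k ⌋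

-- Deleting a vertex v from an induced subgraph G[S] lowers its degree sum by exactly
-- 2·deg_S(v): v loses its own degree and each of its neighbours loses one.  Deleting, as
-- degeneracy allows, a vertex of degree at most d each time shows that the degree sum of a
-- d-degenerate graph is at most 2d|V|.  The vertices of degree above 2d therefore number at
-- most 2d|V|/(2d+1) (Markov), so |V| ≤ (2d+1)|D|.
module Submission where

open import Defs
open import Data.Nat using (ℕ; _≤_; _+_; _*_)
open import Data.Fin.Subset using (∣_∣)

open import Data.Bool using (Bool; true; false; _∧_)
open import Data.Fin using (Fin; zero; suc)
open import Data.Fin.Subset using (Subset; _∈_; _-_; ⊥)
open import Data.Fin.Subset.Properties using (nonempty?; Empty-unique; p─⊥≡p; x∈p⇒∣p-x∣<∣p∣)
open import Data.Nat using (zero; suc; z≤n; _<_; _≤?_)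
open import Data.Nat.Properties
open import Data.Nat.Induction using (<-wellFounded)
open import Induction.WellFounded using (Acc; acc)
open import Data.Vec using ([]; _∷_; here; there; tabulate; lookup)
open import Data.Vec.Properties using (tabulate-cong; lookup∘tabulate)
open import Data.Product using (_,_)
open import Function using (_∘_)
open import Relation.Binary.PropositionalEquality as ≡ hiding (sym)
open import Relation.Nullary.Decidable using (⌊_⌋; yes; no)
open import Algebra.Properties.CommutativeSemigroup +-commutativeSemigroup using (interchange; x∙yz≈y∙xz)

toℕ : Bool → ℕ
toℕ false = 0
toℕ true  = 1

-- Not ⊤ = replicate _ true: this is the form in which deg G = degIn G full holds definitionally.
full : ∀ {n} → Subset n
full = tabulate λ _ → true

infix 8 ∑[_]_

∑[_]_ : ∀ {n} → Subset n → (Fin n → ℕ) → ℕ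
∑[ []        ] f = 0
∑[ true  ∷ S ] f = f zero + ∑[ S ] (f ∘ suc)
∑[ false ∷ S ] f = ∑[ S ] (f ∘ suc)

∑-cong : ∀ {n} (S : Subset n) {f g : Fin n → ℕ} → (∀ u → f u ≡ g u) → ∑[ S ] f ≡ ∑[ S ] g
∑-cong []          f≗g = refl
∑-cong (true  ∷ S) f≗g = cong₂ _+_ (f≗g zero) (∑-cong S (f≗g ∘ suc))
∑-cong (false ∷ S) f≗g = ∑-cong S (f≗g ∘ suc)

∑-mono-≤ : ∀ {n} (S : Subset n) {f g : Fin n → ℕ} → (∀ u → f u ≤ g u) → ∑[ S ] f ≤ ∑[ S ] g
∑-mono-≤ []          f≤g = z≤n
∑-mono-≤ (true  ∷ S) f≤g = +-mono-≤ (f≤g zero) (∑-mono-≤ S (f≤g ∘ suc))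
∑-mono-≤ (false ∷ S) f≤g = ∑-mono-≤ S (f≤g ∘ suc)

∑-distrib-+ : ∀ {n} (S : Subset n) (f g : Fin n → ℕ) →
              ∑[ S ] (λ u → f u + g u) ≡ ∑[ S ] f + ∑[ S ] g
∑-distrib-+ []          f g = refl
∑-distrib-+ (true  ∷ S) f g =
  trans (cong (f zero + g zero +_) (∑-distrib-+ S (f ∘ suc) (g ∘ suc))) (interchange (f zero) (g zero) _ _)
∑-distrib-+ (false ∷ S) f g = ∑-distrib-+ S (f ∘ suc) (g ∘ suc)

∑-distribˡ-* : ∀ {n} (S : Subset n) (c : ℕ) (f : Fin n → ℕ) → ∑[ S ] (λ u → c * f u) ≡ c * ∑[ S ] f
∑-distribˡ-* []          c f = ≡.sym (*-zeroʳ c)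
∑-distribˡ-* (true  ∷ S) c f =
  trans (cong (c * f zero +_) (∑-distribˡ-* S c (f ∘ suc))) (≡.sym (*-distribˡ-+ c (f zero) _))
∑-distribˡ-* (false ∷ S) c f = ∑-distribˡ-* S c (f ∘ suc)

∑-const : ∀ {n} (S : Subset n) (c : ℕ) → ∑[ S ] (λ _ → c) ≡ ∣ S ∣ * c
∑-const []          c = refl
∑-const (true  ∷ S) c = cong (c +_) (∑-const S c)
∑-const (false ∷ S) c = ∑-const S c

∑[⊥] : ∀ n (f : Fin n → ℕ) → ∑[ ⊥ ] f ≡ 0
∑[⊥] zero    f = refl
∑[⊥] (suc n) f = ∑[⊥] n (f ∘ suc)

∑-remove : ∀ {n} {S : Subset n} {v} (f : Fin n → ℕ) → v ∈ S → ∑[ S ] f ≡ f v + ∑[ S - v ] f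
∑-remove {S = true ∷ S} f here = cong (λ T → f zero + ∑[ T ] (f ∘ suc)) (≡.sym (p─⊥≡p S))
∑-remove {S = true ∷ S} {suc v} f (there v∈S) =
  trans (cong (f zero +_) (∑-remove (f ∘ suc) v∈S)) (x∙yz≈y∙xz (f zero) (f (suc v)) _)
∑-remove {S = false ∷ S} f (there v∈S) = ∑-remove (f ∘ suc) v∈S

∣tabulate∧∣≡∑ : ∀ {n} (S : Subset n) (g : Fin n → Bool) →
                ∣ tabulate (λ u → lookup S u ∧ g u) ∣ ≡ ∑[ S ] (toℕ ∘ g)
∣tabulate∧∣≡∑ []          g = refl
∣tabulate∧∣≡∑ (true  ∷ S) g with g zero
... | true  = cong suc (∣tabulate∧∣≡∑ S (g ∘ suc))
... | false = ∣tabulate∧∣≡∑ S (g ∘ suc)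
∣tabulate∧∣≡∑ (false ∷ S) g = ∣tabulate∧∣≡∑ S (g ∘ suc)

∣tabulate∣≡∑ : ∀ {n} (g : Fin n → Bool) → ∣ tabulate g ∣ ≡ ∑[ full ] (toℕ ∘ g)
∣tabulate∣≡∑ g = trans (cong ∣_∣ (tabulate-cong λ u → cong (_∧ g u) (≡.sym (lookup∘tabulate _ u))))
                       (∣tabulate∧∣≡∑ full g)

∣full∣≡n : ∀ n → ∣ full {n} ∣ ≡ n
∣full∣≡n zero    = refl
∣full∣≡n (suc n) = cong suc (∣full∣≡n n)

∣p∣≡1+∣p-x∣ : ∀ {n} {p : Subset n} {x} → x ∈ p → ∣ p ∣ ≡ suc ∣ p - x ∣
∣p∣≡1+∣p-x∣ {p = p} {x} x∈p = begin
  ∣ p ∣                      ≡⟨ *-identityʳ ∣ p ∣ ⟨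
  ∣ p ∣ * 1                  ≡⟨ ∑-const p 1 ⟨
  ∑[ p ] (λ _ → 1)           ≡⟨ ∑-remove (λ _ → 1) x∈p ⟩
  suc (∑[ p - x ] (λ _ → 1)) ≡⟨ cong suc (∑-const (p - x) 1) ⟩
  suc (∣ p - x ∣ * 1)        ≡⟨ cong suc (*-identityʳ ∣ p - x ∣) ⟩
  suc ∣ p - x ∣              ∎
  where open ≡-Reasoning

m+1≤k+[m+1]*[k≤m] : ∀ m k → m + 1 ≤ k + (m + 1) * toℕ ⌊ k ≤? m ⌋
m+1≤k+[m+1]*[k≤m] m k with k ≤? m
... | yes _   = ≤-trans (≤-reflexive (≡.sym (*-identityʳ (m + 1)))) (m≤n+m _ k)
... | no k≰m = ≤-trans (≤-reflexive (+-comm m 1)) (≤-trans (≰⇒> k≰m) (m≤m+n k _))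

markov : ∀ {n} m (w : Fin n → ℕ) → ∑[ full ] w ≤ n * m →
         n ≤ (m + 1) * ∣ tabulate (λ u → ⌊ w u ≤? m ⌋) ∣
markov {n} m w ∑w≤nm = +-cancelˡ-≤ (n * m) n _ (begin
  n * m + n                                   ≡⟨ cong (n * m +_) (*-identityʳ n) ⟨
  n * m + n * 1                               ≡⟨ *-distribˡ-+ n m 1 ⟨
  n * (m + 1)                                 ≡⟨ cong (_* (m + 1)) (∣full∣≡n n) ⟨
  ∣ V ∣ * (m + 1)                             ≡⟨ ∑-const V (m + 1) ⟨
  ∑[ V ] (λ _ → m + 1)                        ≤⟨ ∑-mono-≤ V (λ u → m+1≤k+[m+1]*[k≤m] m (w u)) ⟩
  ∑[ V ] (λ u → w u + (m + 1) * toℕ (low u))  ≡⟨ ∑-distrib-+ V w _ ⟩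
  ∑[ V ] w + ∑[ V ] (λ u → (m + 1) * toℕ (low u))
                                              ≡⟨ cong (∑[ V ] w +_) (∑-distribˡ-* V (m + 1) (toℕ ∘ low)) ⟩
  ∑[ V ] w + (m + 1) * ∑[ V ] (toℕ ∘ low)     ≤⟨ +-monoˡ-≤ _ ∑w≤nm ⟩
  n * m + (m + 1) * ∑[ V ] (toℕ ∘ low)        ≡⟨ cong (λ k → n * m + (m + 1) * k) (∣tabulate∣≡∑ low) ⟨
  n * m + (m + 1) * ∣ tabulate low ∣          ∎)
  where
  open ≤-Reasoning
  V : Subset n
  V = full
  low : Fin n → Bool
  low u = ⌊ w u ≤? m ⌋

module _ {n} (G : Graph n) where

  degIn≡∑ : ∀ S v → degIn G S v ≡ ∑[ S ] (toℕ ∘ adj G v)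
  degIn≡∑ S v = ∣tabulate∧∣≡∑ S (adj G v)

  degIn-remove : ∀ {S v} u → v ∈ S → degIn G S u ≡ toℕ (adj G u v) + degIn G (S - v) u
  degIn-remove {S} {v} u v∈S = begin
    degIn G S u                                     ≡⟨ degIn≡∑ S u ⟩
    ∑[ S ] (toℕ ∘ adj G u)                          ≡⟨ ∑-remove (toℕ ∘ adj G u) v∈S ⟩
    toℕ (adj G u v) + ∑[ S - v ] (toℕ ∘ adj G u)    ≡⟨ cong (toℕ (adj G u v) +_) (degIn≡∑ (S - v) u) ⟨
    toℕ (adj G u v) + degIn G (S - v) u             ∎
    where open ≡-Reasoning

  degIn-remove-self : ∀ {S v} → v ∈ S → degIn G S v ≡ degIn G (S - v) v
  degIn-remove-self {S} {v} v∈S =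
    trans (degIn-remove v v∈S) (cong (λ b → toℕ b + degIn G (S - v) v) (irrefl G v))

  ∑adj≡degIn : ∀ S v → ∑[ S ] (λ u → toℕ (adj G u v)) ≡ degIn G S v
  ∑adj≡degIn S v = trans (∑-cong S λ u → cong toℕ (Graph.sym G u v)) (≡.sym (degIn≡∑ S v))

  ∑degIn-remove : ∀ {S v} → v ∈ S →
                  ∑[ S ] degIn G S ≡ 2 * degIn G S v + ∑[ S - v ] degIn G (S - v)
  ∑degIn-remove {S} {v} v∈S = begin
    ∑[ S ] degIn G S
      ≡⟨ ∑-remove (degIn G S) v∈S ⟩
    x + ∑[ S - v ] degIn G S
      ≡⟨ cong (x +_) (∑-cong (S - v) λ u → degIn-remove u v∈S) ⟩
    x + ∑[ S - v ] (λ u → toℕ (adj G u v) + degIn G (S - v) u)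
      ≡⟨ cong (x +_) (∑-distrib-+ (S - v) _ _) ⟩
    x + (∑[ S - v ] (λ u → toℕ (adj G u v)) + R)
      ≡⟨ cong (λ y → x + (y + R)) (trans (∑adj≡degIn (S - v) v) (≡.sym (degIn-remove-self v∈S))) ⟩
    x + (x + R)
      ≡⟨ +-assoc x x R ⟨
    x + x + R
      ≡⟨ cong (λ y → x + y + R) (+-identityʳ x) ⟨
    2 * x + R
      ∎
    where
    open ≡-Reasoning
    x : ℕ
    x = degIn G S v
    R : ℕ
    R = ∑[ S - v ] degIn G (S - v)

  degenerate⇒∑degIn≤ : ∀ {d} → Degenerate d G → ∀ S → ∑[ S ] degIn G S ≤ ∣ S ∣ * (2 * d)
  degenerate⇒∑degIn≤ {d} degenerate S = go S (<-wellFounded ∣ S ∣)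
    where
    go : ∀ S → Acc _<_ ∣ S ∣ → ∑[ S ] degIn G S ≤ ∣ S ∣ * (2 * d)
    go S (acc smaller) with nonempty? S
    ... | no empty = subst (λ T → ∑[ T ] degIn G T ≤ ∣ T ∣ * (2 * d)) (≡.sym (Empty-unique empty))
                           (≤-trans (≤-reflexive (∑[⊥] n (degIn G ⊥))) z≤n)
    ... | yes nonempty with degenerate S nonempty
    ... | v , v∈S , degv≤d = begin
      ∑[ S ] degIn G S                              ≡⟨ ∑degIn-remove v∈S ⟩
      2 * degIn G S v + ∑[ S - v ] degIn G (S - v)  ≤⟨ +-mono-≤ (*-monoʳ-≤ 2 degv≤d)
                                                                (go (S - v) (smaller (x∈p⇒∣p-x∣<∣p∣ v∈S))) ⟩
      2 * d + ∣ S - v ∣ * (2 * d)                   ≡⟨ cong (_* (2 * d)) (∣p∣≡1+∣p-x∣ v∈S) ⟨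
      ∣ S ∣ * (2 * d)                               ∎
      where open ≤-Reasoning

lemma3 : (d n : ℕ) (G : Graph n) → Degenerate d G →
         n ≤ (2 * d + 1) * ∣ lowDeg G (2 * d) ∣
lemma3 d n G degenerate = markov (2 * d) (deg G) ∑deg≤n*2d
  where
  ∑deg≤n*2d : ∑[ full ] deg G ≤ n * (2 * d)
  ∑deg≤n*2d = subst (λ k → ∑[ full ] deg G ≤ k * (2 * d)) (∣full∣≡n n)
                    (degenerate⇒∑degIn≤ G degenerate full)
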